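{- Let $G$ be a connected bipartite graph with a unique perfect matching $\mathcal{M}$ such that every cycle of $G$ contains an even number of edges not in $\mathcal{M}$. Then for every $u\in V(G)$, $D_uA(G)D_u=H_{ -1}(X_G)$.
   Context: $A(G)$ is the adjacency matrix of $G$. $X_G$ is the mixed graph obtained from $G$ by orienting all edges not in $\mathcal{M}$ (matching edges stay undirected); its $(-1)$-hermitian adjacency matrix $H_{ -1}(X_G)=[h_{xy}]$ has $h_{xy}=1$ if $xy\in\mathcal{M}$, $h_{xy}=-1$ if $xy$ is an edge of $G$ not in $\mathcal{M}$ (arc in either direction, since $\overline{ -1}=-1$), and $h_{xy}=0$ otherwise. For a fixed $u\in V(G)$ and any $v\in V(G)$, define $w(v)=(-1)^{t}$ where $t$ is the number of edges not in $\mathcal{M}$ on a path from $u$ to $v$ (under the hypothesis on cycles this does not depend on the chosen path; $w(u)=1$). With $V(G)=\{v_1,\dots,v_n\}$, $D_u=\mathrm{diag}\{w(v_1),\dots,w(v_n)\}$. -}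

module Defs where

open import Data.Nat using (ℕ; zero; suc; _≤_)
open import Data.Fin using (Fin)
import Data.Fin
import Data.Nat
open import Data.Bool using (Bool; true; false; if_then_else_)
open import Data.Integer using (ℤ; +_; -_; _+_; _*_)
open import Data.List using (List; []; _∷_)
open import Data.List.Relation.Unary.Unique.Propositional using (Unique)
open import Data.Product using (Σ; ∃; _×_; _,_)
open import Relation.Binary.PropositionalEquality using (_≡_; _≢_)
open import Relation.Nullary using (¬_)

record Graph (n : ℕ) : Set where
  field
    adj     : Fin n → Fin n → Bool
    symm    : ∀ x y → adj x y ≡ adj y x
    irrefl  : ∀ x → adj x x ≡ false
open Graph public

data Walk {n : ℕ} (G : Graph n) : Fin n → Fin n → Set where
  [_]   : (x : Fin n) → Walk G x x
  _∷⟨_⟩_ : (x : Fin n) {y z : Fin n} → adj G x y ≡ true → Walk G y z → Walk G x z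

vertices : ∀ {n} {G : Graph n} {x y} → Walk G x y → List (Fin n)
vertices [ x ] = x ∷ []
vertices (x ∷⟨ _ ⟩ w) = x ∷ vertices w

walkLength : ∀ {n} {G : Graph n} {x y} → Walk G x y → ℕ
walkLength [ _ ] = zero
walkLength (_ ∷⟨ _ ⟩ w) = suc (walkLength w)

IsPath : ∀ {n} {G : Graph n} {x y} → Walk G x y → Set
IsPath w = Unique (vertices w)

Path : ∀ {n} (G : Graph n) → Fin n → Fin n → Set
Path G x y = Σ (Walk G x y) IsPath

tailL : ∀ {A : Set} → List A → List A
tailL [] = []
tailL (_ ∷ xs) = xs

IsCycle : ∀ {n} {G : Graph n} {x} → Walk G x x → Set
IsCycle w = (3 ≤ walkLength w) × Unique (tailL (vertices w))

Connected : ∀ {n} → Graph n → Set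
Connected G = ∀ x y → Path G x y

Bipartite : ∀ {n} → Graph n → Set
Bipartite {n} G = Σ (Fin n → Bool) λ c → ∀ x y → adj G x y ≡ true → c x ≢ c y

EdgeSet : ℕ → Set
EdgeSet n = Fin n → Fin n → Bool

IsPerfectMatching : ∀ {n} → Graph n → EdgeSet n → Set
IsPerfectMatching {n} G M =
  (∀ x y → M x y ≡ M y x) ×
  (∀ x y → M x y ≡ true → adj G x y ≡ true) ×
  (∀ x → Σ (Fin n) λ y → M x y ≡ true × (∀ z → M x z ≡ true → z ≡ y))

IsUniquePerfectMatching : ∀ {n} → Graph n → EdgeSet n → Set
IsUniquePerfectMatching G M =
  IsPerfectMatching G M × (∀ M′ → IsPerfectMatching G M′ → ∀ x y → M′ x y ≡ M x y)

nonM : ∀ {n} {G : Graph n} (M : EdgeSet n) {x y} → Walk G x y → ℕ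
nonM M [ _ ] = zero
nonM M (_∷⟨_⟩_ x {y} _ w) = (if M x y then zero else suc zero) Data.Nat.+ nonM M w

data Even : ℕ → Set where
  even-zero : Even zero
  even-ss   : ∀ {k} → Even k → Even (suc (suc k))

signℤ : ℕ → ℤ
signℤ zero = + 1
signℤ (suc t) = - signℤ t

Matrix : ℕ → Set
Matrix n = Fin n → Fin n → ℤ

sumFin : ∀ {n} → (Fin n → ℤ) → ℤ
sumFin {zero} f = + 0
sumFin {suc n} f = f Fin.zero + sumFin (λ i → f (Fin.suc i))

_⊗_ : ∀ {n} → Matrix n → Matrix n → Matrix n
(A ⊗ B) i j = sumFin (λ k → A i k * B k j)

diag : ∀ {n} → (Fin n → ℤ) → Matrix n
diag d i j with i Data.Fin.≟ j
... | Relation.Nullary.yes _ = d i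
... | Relation.Nullary.no _ = + 0

adjMatrix : ∀ {n} → Graph n → Matrix n
adjMatrix G x y = if adj G x y then + 1 else + 0

H₋₁ : ∀ {n} → Graph n → EdgeSet n → Matrix n
H₋₁ G M x y = if M x y then + 1 else (if adj G x y then - (+ 1) else + 0)

weight : ∀ {n} {G : Graph n} (M : EdgeSet n) {u : Fin n} →
         ((v : Fin n) → Path G u v) → Fin n → ℤ
weight M p v with p v
... | (w , _) = signℤ (nonM M w)

Dmat : ∀ {n} {G : Graph n} (M : EdgeSet n) {u : Fin n} →
       ((v : Fin n) → Path G u v) → Matrix n
Dmat M p = diag (weight M p)

{-# OPTIONS --safe #-}
-- Conjugating by a diagonal matrix scales entry xy by w(x) w(y), so the claim is
-- that for every edge xy the product w(x) w(y) is +1 on matching edges and -1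
-- otherwise. The edge xy followed by the paths y → u → x is a closed walk, so it
-- suffices that every closed walk has an even number of edges outside M: a closed
-- walk with a repeated vertex splits into two shorter closed walks, and one
-- without is a cycle or an edge traversed back and forth.
module Submission where

open import Defs
open import Data.Nat using (ℕ; zero; suc; _<_; _≤_; z≤n; s≤s)
import Data.Nat as ℕ
open import Data.Nat.Induction using (<-wellFounded)
open import Data.Nat.Properties as ℕₚ using (+-assoc; +-comm; m≤m+n; m<n+m; m≤n⇒m≤1+n)
open import Data.Fin using (Fin) renaming (zero to fzero; suc to fsuc)
open import Data.Fin.Properties using (suc-injective) renaming (_≟_ to _≟ᶠ_)
open import Data.Bool using (Bool; true; false; if_then_else_)
open import Data.Integer using (ℤ; +_; -_; _*_)
open import Data.Integer.Properties
  using (*-comm; *-identityˡ; *-identityʳ; *-zeroʳ; +-identityˡ; +-identityʳ;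
         neg-distribˡ-*; neg-involutive)
open import Data.List.Relation.Unary.Any using (here; there)
open import Data.List.Relation.Unary.All using ([])
open import Data.List.Relation.Unary.All.Properties using (¬Any⇒All¬)
open import Data.List.Relation.Unary.AllPairs using ([]; _∷_)
open import Data.List.Membership.Propositional using (_∈_)
import Data.List.Membership.DecPropositional as DecMembership
open import Data.List.Relation.Unary.Unique.Propositional using (Unique)
open import Data.Product using (∃₂; _,_; proj₁)
open import Data.Sum using (_⊎_; inj₁; inj₂)
open import Data.Empty using (⊥-elim)
open import Function using (_∘_)
open import Induction.WellFounded using (Acc; acc)
open import Relation.Nullary using (yes; no)
open import Relation.Binary.PropositionalEquality

Even-+ : ∀ {a b} → Even a → Even b → Even (a ℕ.+ b)
Even-+ even-zero    eb = eb
Even-+ (even-ss ea) eb = even-ss (Even-+ ea eb)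

signℤ-+ : ∀ a b → signℤ (a ℕ.+ b) ≡ signℤ a * signℤ b
signℤ-+ zero    b = sym (*-identityˡ (signℤ b))
signℤ-+ (suc a) b = trans (cong -_ (signℤ-+ a b)) (neg-distribˡ-* (signℤ a) (signℤ b))

signℤ-even : ∀ {k} → Even k → signℤ k ≡ + 1
signℤ-even even-zero       = refl
signℤ-even (even-ss {k} e) = trans (neg-involutive (signℤ k)) (signℤ-even e)

signℤ-odd : ∀ {k} → Even (suc k) → signℤ k ≡ - (+ 1)
signℤ-odd {suc k} (even-ss e) = cong -_ (signℤ-even e)

signℤ-by-parity : ∀ (m : Bool) {k} → Even ((if m then 0 else 1) ℕ.+ k) →
                  signℤ k ≡ (if m then + 1 else - (+ 1))
signℤ-by-parity true  = signℤ-even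
signℤ-by-parity false = signℤ-odd

sumFin-zero : ∀ {n} (f : Fin n → ℤ) → (∀ j → f j ≡ + 0) → sumFin f ≡ + 0
sumFin-zero {zero}  f f≡0 = refl
sumFin-zero {suc n} f f≡0
  rewrite f≡0 fzero | sumFin-zero (f ∘ fsuc) (f≡0 ∘ fsuc) = refl

sumFin-single : ∀ {n} (f : Fin n → ℤ) i → (∀ j → j ≢ i → f j ≡ + 0) → sumFin f ≡ f i
sumFin-single {suc n} f fzero f≡0
  rewrite sumFin-zero (f ∘ fsuc) (λ j → f≡0 (fsuc j) λ ()) = +-identityʳ (f fzero)
sumFin-single {suc n} f (fsuc i) f≡0 rewrite f≡0 fzero (λ ()) =
  trans (+-identityˡ _) (sumFin-single (f ∘ fsuc) i (λ j j≢i → f≡0 (fsuc j) (j≢i ∘ suc-injective)))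

diag-≡ : ∀ {n} (d : Fin n → ℤ) i → diag d i i ≡ d i
diag-≡ d i with i ≟ᶠ i
... | yes _   = refl
... | no i≢i = ⊥-elim (i≢i refl)

diag-≢ : ∀ {n} (d : Fin n → ℤ) i j → i ≢ j → diag d i j ≡ + 0
diag-≢ d i j i≢j with i ≟ᶠ j
... | yes i≡j = ⊥-elim (i≢j i≡j)
... | no _    = refl

diag-⊗ : ∀ {n} (d : Fin n → ℤ) (A : Matrix n) i j → (diag d ⊗ A) i j ≡ d i * A i j
diag-⊗ d A i j =
  trans (sumFin-single (λ k → diag d i k * A k j) i
                       (λ k k≢i → cong (_* A k j) (diag-≢ d i k (k≢i ∘ sym))))
        (cong (_* A i j) (diag-≡ d i))

⊗-diag : ∀ {n} (A : Matrix n) (d : Fin n → ℤ) i j → (A ⊗ diag d) i j ≡ A i j * d j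
⊗-diag A d i j =
  trans (sumFin-single (λ k → A i k * diag d k j) j
                       (λ k k≢j → trans (cong (A i k *_) (diag-≢ d k j k≢j)) (*-zeroʳ (A i k))))
        (cong (A i j *_) (diag-≡ d j))

diag-⊗-diag : ∀ {n} (d : Fin n → ℤ) (A : Matrix n) (e : Fin n → ℤ) i j →
              ((diag d ⊗ A) ⊗ diag e) i j ≡ d i * A i j * e j
diag-⊗-diag d A e i j = trans (⊗-diag (diag d ⊗ A) e i j) (cong (_* e j) (diag-⊗ d A i j))

module Walks {n : ℕ} (G : Graph n) where

  infixr 5 _++ʷ_

  _++ʷ_ : ∀ {a b c} → Walk G a b → Walk G b c → Walk G a c
  [ _ ]        ++ʷ w = w
  (x ∷⟨ e ⟩ v) ++ʷ w = x ∷⟨ e ⟩ (v ++ʷ w)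

  reverseʷ : ∀ {a b} → Walk G a b → Walk G b a
  reverseʷ [ a ]                = [ a ]
  reverseʷ (_∷⟨_⟩_ a {y} e w) = reverseʷ w ++ʷ (y ∷⟨ trans (symm G y a) e ⟩ [ a ])

  walkLength-++ : ∀ {a b c} (v : Walk G a b) (w : Walk G b c) →
                  walkLength (v ++ʷ w) ≡ walkLength v ℕ.+ walkLength w
  walkLength-++ [ _ ]        w = refl
  walkLength-++ (_ ∷⟨ _ ⟩ v) w = cong suc (walkLength-++ v w)

  excise-< : ∀ {a v b} (w₁ : Walk G a v) (loop : Walk G v v) (w₃ : Walk G v b) →
             0 < walkLength loop → walkLength (w₁ ++ʷ w₃) < walkLength (w₁ ++ʷ loop ++ʷ w₃)
  excise-< [ _ ] loop w₃ loop>0 rewrite walkLength-++ loop w₃ = m<n+m (walkLength w₃) loop>0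
  excise-< (_ ∷⟨ _ ⟩ w₁) loop w₃ loop>0 = s≤s (excise-< w₁ loop w₃ loop>0)

  loop-≤ : ∀ {a v b} (w₁ : Walk G a v) (loop : Walk G v v) (w₃ : Walk G v b) →
           walkLength loop ≤ walkLength (w₁ ++ʷ loop ++ʷ w₃)
  loop-≤ [ _ ] loop w₃ rewrite walkLength-++ loop w₃ = m≤m+n (walkLength loop) (walkLength w₃)
  loop-≤ (_ ∷⟨ _ ⟩ w₁) loop w₃ = m≤n⇒m≤1+n (loop-≤ w₁ loop w₃)

  splitAt : ∀ {a b v} (w : Walk G a b) → v ∈ vertices w →
            ∃₂ λ (w₁ : Walk G a v) (w₂ : Walk G v b) → w ≡ w₁ ++ʷ w₂
  splitAt [ a ]        (here refl) = [ a ] , [ a ] , refl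
  splitAt (a ∷⟨ e ⟩ w) (here refl) = [ a ] , a ∷⟨ e ⟩ w , refl
  splitAt (a ∷⟨ e ⟩ w) (there v∈w) with splitAt w v∈w
  ... | w₁ , w₂ , refl = a ∷⟨ e ⟩ w₁ , w₂ , refl

  data Revisit {a b} : Walk G a b → Set where
    revisit : ∀ {v} (w₁ : Walk G a v) (loop : Walk G v v) (w₃ : Walk G v b) →
              0 < walkLength loop → Revisit (w₁ ++ʷ loop ++ʷ w₃)

  open DecMembership (_≟ᶠ_ {n}) using (_∈?_)

  unique⊎revisit : ∀ {a b} (w : Walk G a b) → Unique (vertices w) ⊎ Revisit w
  unique⊎revisit [ a ] = inj₁ ([] ∷ [])
  unique⊎revisit (a ∷⟨ e ⟩ w) with unique⊎revisit w
  ... | inj₂ (revisit w₁ loop w₃ loop>0) = inj₂ (revisit (a ∷⟨ e ⟩ w₁) loop w₃ loop>0)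
  ... | inj₁ unique with a ∈? vertices w
  ...   | no a∉w  = inj₁ (¬Any⇒All¬ (vertices w) a∉w ∷ unique)
  ...   | yes a∈w with splitAt w a∈w
  ...     | w₁ , w₂ , refl = inj₂ (revisit [ a ] (a ∷⟨ e ⟩ w₁) w₂ (s≤s z≤n))

module _ {n : ℕ} {G : Graph n} (M : EdgeSet n) where

  open Walks G

  nonM-edge : Fin n → Fin n → ℕ
  nonM-edge x y = if M x y then 0 else 1

  nonM-++ : ∀ {a b c} (v : Walk G a b) (w : Walk G b c) → nonM M (v ++ʷ w) ≡ nonM M v ℕ.+ nonM M w
  nonM-++ [ _ ]                 w = refl
  nonM-++ (_∷⟨_⟩_ x {y} _ v) w =
    trans (cong (nonM-edge x y ℕ.+_) (nonM-++ v w)) (sym (+-assoc (nonM-edge x y) (nonM M v) (nonM M w)))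

  nonM-excise : ∀ {a v b} (w₁ : Walk G a v) (loop : Walk G v v) (w₃ : Walk G v b) →
                nonM M (w₁ ++ʷ loop ++ʷ w₃) ≡ nonM M (w₁ ++ʷ w₃) ℕ.+ nonM M loop
  nonM-excise [ _ ] loop w₃ = trans (nonM-++ loop w₃) (+-comm (nonM M loop) (nonM M w₃))
  nonM-excise (_∷⟨_⟩_ x {y} _ w₁) loop w₃ =
    trans (cong (nonM-edge x y ℕ.+_) (nonM-excise w₁ loop w₃))
          (sym (+-assoc (nonM-edge x y) (nonM M (w₁ ++ʷ w₃)) (nonM M loop)))

  module _ (M-sym : ∀ x y → M x y ≡ M y x) where

    nonM-reverse : ∀ {a b} (w : Walk G a b) → nonM M (reverseʷ w) ≡ nonM M w
    nonM-reverse [ a ] = refl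
    nonM-reverse (_∷⟨_⟩_ a {y} e w) = begin
      nonM M (reverseʷ w ++ʷ back)           ≡⟨ nonM-++ (reverseʷ w) back ⟩
      nonM M (reverseʷ w) ℕ.+ nonM M back    ≡⟨ cong₂ ℕ._+_ (nonM-reverse w) nonM-back ⟩
      nonM M w ℕ.+ nonM-edge a y             ≡⟨ +-comm (nonM M w) (nonM-edge a y) ⟩
      nonM-edge a y ℕ.+ nonM M w             ∎
      where
      open ≡-Reasoning
      back : Walk G y a
      back = y ∷⟨ trans (symm G y a) e ⟩ [ a ]
      nonM-back : nonM M back ≡ nonM-edge a y
      nonM-back rewrite M-sym y a = ℕₚ.+-identityʳ (nonM-edge a y)

    backtrack-even : ∀ {x y} (e : adj G x y ≡ true) (e′ : adj G y x ≡ true) →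
                     Even (nonM {G = G} M (x ∷⟨ e ⟩ (y ∷⟨ e′ ⟩ [ x ])))
    backtrack-even {x} {y} _ _ rewrite M-sym y x with M x y
    ... | true  = even-zero
    ... | false = even-ss even-zero

    module _ (cycle-even : ∀ x (c : Walk G x x) → IsCycle c → Even (nonM M c)) where

      unique-closedWalk-even : ∀ {x y} (e : adj G x y ≡ true) (w : Walk G y x) →
                               Unique (vertices w) → Even (nonM M (x ∷⟨ e ⟩ w))
      unique-closedWalk-even {x} e [ _ ] _ with trans (sym e) (irrefl G x)
      ... | ()
      unique-closedWalk-even e (_ ∷⟨ e′ ⟩ [ _ ]) _ = backtrack-even e e′
      unique-closedWalk-even {x} e w@(_ ∷⟨ _ ⟩ (_ ∷⟨ _ ⟩ _)) unique =
        cycle-even x (x ∷⟨ e ⟩ w) (s≤s (s≤s (s≤s z≤n)) , unique)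

      closedWalk-even-acc : ∀ {x} (c : Walk G x x) → Acc _<_ (walkLength c) → Even (nonM M c)
      closedWalk-even-acc [ _ ] _ = even-zero
      closedWalk-even-acc (x ∷⟨ e ⟩ w) (acc shorter) with unique⊎revisit w
      ... | inj₁ unique = unique-closedWalk-even e w unique
      ... | inj₂ (revisit w₁ loop w₃ loop>0) =
        subst Even (sym (nonM-excise (x ∷⟨ e ⟩ w₁) loop w₃))
          (Even-+ (closedWalk-even-acc (x ∷⟨ e ⟩ (w₁ ++ʷ w₃))
                                       (shorter (excise-< (x ∷⟨ e ⟩ w₁) loop w₃ loop>0)))
                  (closedWalk-even-acc loop (shorter (s≤s (loop-≤ w₁ loop w₃)))))

      closedWalk-even : ∀ {x} (c : Walk G x x) → Even (nonM M c)
      closedWalk-even c = closedWalk-even-acc c (<-wellFounded (walkLength c))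

      edge-sign : ∀ {u x y} (pₓ : Walk G u x) (p_y : Walk G u y) → adj G x y ≡ true →
                  signℤ (nonM M pₓ) * signℤ (nonM M p_y) ≡ (if M x y then + 1 else - (+ 1))
      edge-sign {x = x} {y} pₓ p_y e = begin
        signℤ a * signℤ b  ≡⟨ *-comm (signℤ a) (signℤ b) ⟩
        signℤ b * signℤ a  ≡⟨ sym (signℤ-+ b a) ⟩
        signℤ (b ℕ.+ a)    ≡⟨ signℤ-by-parity (M x y) (subst Even nonM-closed (closedWalk-even closed)) ⟩
        (if M x y then + 1 else - (+ 1)) ∎
        where
        open ≡-Reasoning
        a = nonM M pₓ
        b = nonM M p_y
        closed : Walk G x x
        closed = x ∷⟨ e ⟩ (reverseʷ p_y ++ʷ pₓ)
        nonM-closed : nonM M closed ≡ nonM-edge x y ℕ.+ (b ℕ.+ a)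
        nonM-closed = cong (nonM-edge x y ℕ.+_)
                           (trans (nonM-++ (reverseʷ p_y) pₓ) (cong (ℕ._+ a) (nonM-reverse p_y)))

conjugated-entry : ∀ (s t : ℤ) (m a : Bool) → (m ≡ true → a ≡ true) →
                   (a ≡ true → s * t ≡ (if m then + 1 else - (+ 1))) →
                   s * (if a then + 1 else + 0) * t ≡ (if m then + 1 else (if a then - (+ 1) else + 0))
conjugated-entry s t m     true  _   edge rewrite *-identityʳ s = edge refl
conjugated-entry s t true  false m⊆a _ with m⊆a refl
... | ()
conjugated-entry s t false false _   _ rewrite *-zeroʳ s = refl

theorem9 : (n : ℕ) (G : Graph n) (M : EdgeSet n) →
    Connected G → Bipartite G → IsUniquePerfectMatching G M →
    (∀ (x : Fin n) (c : Walk G x x) → IsCycle c → Even (nonM M c)) →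
    (u : Fin n) (p : (v : Fin n) → Path G u v) →
    ∀ (x y : Fin n) → ((Dmat M p ⊗ adjMatrix G) ⊗ Dmat M p) x y ≡ H₋₁ G M x y
theorem9 n G M _ _ ((M-sym , M⊆G , _) , _) cycle-even u p x y = begin
  ((Dmat M p ⊗ adjMatrix G) ⊗ Dmat M p) x y
    ≡⟨ diag-⊗-diag (weight M p) (adjMatrix G) (weight M p) x y ⟩
  signℤ (nonM M pₓ) * adjMatrix G x y * signℤ (nonM M p_y)
    ≡⟨ conjugated-entry (signℤ (nonM M pₓ)) (signℤ (nonM M p_y)) (M x y) (adj G x y) (M⊆G x y)
                        (edge-sign M M-sym cycle-even pₓ p_y) ⟩
  H₋₁ G M x y ∎
  where
  open ≡-Reasoning
  pₓ : Walk G u x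
  pₓ = proj₁ (p x)
  p_y : Walk G u y
  p_y = proj₁ (p y)
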